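{- For every integer $n\ge 1$, $$K_n:=\prod_{b=0}^{2^n-1}\frac{3^{M_{n-1}(b)}}{2^n}=\left(\frac{3}{4}\right)^{2^{n-1}\,n}.$$
   Context: Let $T^1:\mathbb{N}\to\mathbb{N}$ be the Collatz function, $T^1(N)=N/2$ if $N$ is even and $T^1(N)=\frac{3N+1}{2}$ if $N$ is odd; in particular $T^1(0)=0$. Write $T^1_k$ for the $k$-th iterate of $T^1$, with $T^1_0$ the identity. For an integer $n\ge1$ and $b\in\{0,1,\dots,2^n-1\}$, let $M_{n-1}(b)$ be the number of odd integers among the $n$ terms $b, T^1_1(b),\dots,T^1_{n-1}(b)$. In particular $M_{n-1}(0)=0$ and $T^1_n(0)=0$. For $b=b_i=i-1$ with $1\le i\le 2^n$, the number $A_{n,i}=3^{M_{n-1}(b_i)}/2^n$ is the coefficient of $P$ in the affine expression $T^1_n(P)=A_{n,i}P+B_{n,i}$, valid for all positive integers $P\equiv b_i \pmod{2^n}$. Thus $K_n$ is the product of these $2^n$ coefficients. -}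

module Defs where

open import Data.Nat as ℕ using (ℕ; zero; suc; _+_; _*_; _%_; _/_; _≡ᵇ_)
open import Data.Bool using (Bool; true; false; if_then_else_)
open import Data.List using (List; map; upTo; foldr)
open import Data.Rational as ℚ using (ℚ; 1ℚ)
open import Data.Integer using (+_)

T1 : ℕ → ℕ
T1 N = if N % 2 ≡ᵇ 0 then N / 2 else (3 * N + 1) / 2

T1^ : ℕ → ℕ → ℕ
T1^ zero    N = N
T1^ (suc k) N = T1 (T1^ k N)

isOdd : ℕ → Bool
isOdd N = N % 2 ≡ᵇ 1

oddCount : ℕ → ℕ → ℕ
oddCount zero    b = 0
oddCount (suc m) b = oddCount m b + (if isOdd (T1^ m b) then 1 else 0)

-- M_{n-1}(b): number of odd integers among b, T¹_1(b), …, T¹_{n-1}(b)  (n terms)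
M : ℕ → ℕ → ℕ
M n b = oddCount n b

_^ℚ_ : ℚ → ℕ → ℚ
q ^ℚ zero  = 1ℚ
q ^ℚ suc k = q ℚ.* (q ^ℚ k)

prodℚ : List ℚ → ℚ
prodℚ = foldr ℚ._*_ 1ℚ

A : ℕ → ℕ → ℚ
A n b = ((+ (3 ℕ.^ M n b)) ℚ./ 1) ℚ.* ((ℚ.½) ^ℚ n)

K : ℕ → ℚ
K n = prodℚ (map (A n) (upTo (2 ℕ.^ n)))

-- For each k < n, the affine form of T¹ₖ on residue classes gives
-- T¹ₖ(b + 2ᵏ) = T¹ₖ(b) + 3^{Mₖ₋₁(b)}, and 3^{Mₖ₋₁(b)} is odd, so b ↦ b + 2ᵏ
-- flips the parity of T¹ₖ(b). Hence T¹ₖ(b) is odd for exactly half of the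
-- residues b < 2ⁿ, and Σ_{b<2ⁿ} M_{n-1}(b) = n·2ⁿ⁻¹. The product is therefore
-- 3^{n·2ⁿ⁻¹} / 2^{n·2ⁿ} = (3/4)^{n·2ⁿ⁻¹}.
module Submission where

open import Defs
open import Data.Nat using (ℕ; suc; _*_; _^_)
open import Data.Rational using (_/_)
open import Data.Integer using (+_)
open import Relation.Binary.PropositionalEquality using (_≡_)

open import Data.Nat using (zero; _+_; _<_; s≤s)
import Data.Nat as ℕ using (_/_)
open import Data.Nat.Properties
  using (+-identityʳ; +-suc; +-assoc; +-comm; *-comm; *-identityʳ; *-identityˡ; *-zeroʳ;
         *-suc; ^-distribˡ-+-*; m<n⇒m<1+n; ≤-refl; m≤n⇒∃[o]m+o≡n)
open import Data.Nat.DivMod using (m*n%n≡0; [m+kn]%n≡m%n; m*n/n≡m)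
open import Data.Nat.ListAction using (sum)
open import Data.Nat.ListAction.Properties using (sum-++)
open import Data.Nat.Solver using (module +-*-Solver)
open +-*-Solver using (solve; _:=_; con; _:+_; _:*_)
open import Data.Bool using (if_then_else_)
open import Data.Product using (∃; _,_)
open import Data.List using ([]; _∷_; _++_; map; length; upTo; [_])
open import Data.List.Properties using (map-++; map-cong; upTo-∷ʳ; length-upTo)
open import Data.Rational as ℚ using (ℚ; mkℚ; ½)
import Data.Rational.Properties as ℚP
import Data.Integer.Properties as ℤP
import Data.Nat.Coprimality as Coprimality
open import Algebra.Bundles using (CommutativeMonoid)
open import Algebra.Properties.CommutativeSemigroup
  (CommutativeMonoid.commutativeSemigroup ℚP.*-1-commutativeMonoid) using (interchange)
open import Relation.Binary.PropositionalEquality using (refl; sym; trans; cong; cong₂; module ≡-Reasoning)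

open ≡-Reasoning

data Parity : ℕ → Set where
  even : ∀ q → Parity (q * 2)
  odd  : ∀ q → Parity (1 + q * 2)

parity : ∀ N → Parity N
parity zero = even 0
parity (suc N) with parity N
... | even q = odd q
... | odd q  = even (suc q)

oddBit : ℕ → ℕ
oddBit N = if isOdd N then 1 else 0

oddBit-even : ∀ q → oddBit (q * 2) ≡ 0
oddBit-even q rewrite m*n%n≡0 q 2 ⦃ _ ⦄ = refl

oddBit-odd : ∀ q → oddBit (1 + q * 2) ≡ 1
oddBit-odd q rewrite [m+kn]%n≡m%n 1 q 2 ⦃ _ ⦄ = refl

T1-even : ∀ q → T1 (q * 2) ≡ q
T1-even q rewrite m*n%n≡0 q 2 ⦃ _ ⦄ = m*n/n≡m q 2

T1-odd : ∀ q → T1 (1 + q * 2) ≡ 2 + 3 * q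
T1-odd q rewrite [m+kn]%n≡m%n 1 q 2 ⦃ _ ⦄ = begin
  (3 * (1 + q * 2) + 1) ℕ./ 2 ≡⟨ cong (ℕ._/ 2) (solve 1 (λ q → con 3 :* (con 1 :+ q :* con 2) :+ con 1
                                                        := (con 2 :+ con 3 :* q) :* con 2) refl q) ⟩
  (2 + 3 * q) * 2 ℕ./ 2       ≡⟨ m*n/n≡m (2 + 3 * q) 2 ⟩
  2 + 3 * q                   ∎

T1-+2* : ∀ N y → T1 (N + 2 * y) ≡ T1 N + 3 ^ oddBit N * y
T1-+2* N y with parity N
... | even q rewrite oddBit-even q | T1-even q = begin
  T1 (q * 2 + 2 * y)  ≡⟨ cong T1 (solve 2 (λ q y → q :* con 2 :+ con 2 :* y := (q :+ y) :* con 2) refl q y) ⟩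
  T1 ((q + y) * 2)    ≡⟨ T1-even (q + y) ⟩
  q + y               ≡⟨ cong (_+_ (q)) (sym (*-identityˡ y)) ⟩
  q + 1 * y           ∎
... | odd q rewrite oddBit-odd q | T1-odd q = begin
  T1 (1 + q * 2 + 2 * y)    ≡⟨ cong T1 (solve 2 (λ q y → con 1 :+ q :* con 2 :+ con 2 :* y
                                                       := con 1 :+ (q :+ y) :* con 2) refl q y) ⟩
  T1 (1 + (q + y) * 2)      ≡⟨ T1-odd (q + y) ⟩
  2 + 3 * (q + y)           ≡⟨ solve 2 (λ q y → con 2 :+ con 3 :* (q :+ y) := con 2 :+ con 3 :* q :+ con 3 :* y) refl q y ⟩
  2 + 3 * q + 3 * y         ∎

-- Generalised over k so that the induction on j can spend one factor of 2 per step.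
T1^-affine : ∀ j k b x → T1^ j (b + 2 ^ (j + k) * x) ≡ T1^ j b + 3 ^ oddCount j b * 2 ^ k * x
T1^-affine zero k b x = cong (λ c → b + c * x) (sym (+-identityʳ (2 ^ k)))
T1^-affine (suc j) k b x = begin
  T1 (T1^ j (b + 2 ^ suc (j + k) * x))  ≡⟨ cong (λ e → T1 (T1^ j (b + 2 ^ e * x))) (sym (+-suc j k)) ⟩
  T1 (T1^ j (b + 2 ^ (j + suc k) * x))  ≡⟨ cong T1 (T1^-affine j (suc k) b x) ⟩
  T1 (N + C * (2 * P) * x)              ≡⟨ cong (λ e → T1 (N + e))
                                             (solve 3 (λ C P x → C :* (con 2 :* P) :* x := con 2 :* (C :* P :* x)) refl C P x) ⟩
  T1 (N + 2 * (C * P * x))              ≡⟨ T1-+2* N (C * P * x) ⟩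
  T1 N + 3 ^ oddBit N * (C * P * x)     ≡⟨ cong (_+_ (T1 N)) (solve 4 (λ f C P x → f :* (C :* P :* x) := C :* f :* P :* x)
                                                                 refl (3 ^ oddBit N) C P x) ⟩
  T1 N + C * 3 ^ oddBit N * P * x       ≡⟨ cong (λ e → T1 N + e * P * x) (sym (^-distribˡ-+-* 3 (oddCount j b) (oddBit N))) ⟩
  T1 N + 3 ^ (oddCount j b + oddBit N) * P * x ∎
  where
  N = T1^ j b
  C = 3 ^ oddCount j b
  P = 2 ^ k

3^-odd : ∀ c → ∃ λ r → 3 ^ c ≡ 1 + r * 2
3^-odd zero = 0 , refl
3^-odd (suc c) with 3^-odd c
... | r , 3^c≡ = 1 + 3 * r , trans (cong (3 *_) 3^c≡)
                                   (solve 1 (λ r → con 3 :* (con 1 :+ r :* con 2) := con 1 :+ (con 1 :+ con 3 :* r) :* con 2) refl r)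

oddBit-+odd : ∀ N r → oddBit (N + (1 + r * 2)) + oddBit N ≡ 1
oddBit-+odd N r with parity N
... | even q = cong₂ _+_
  (trans (cong oddBit (solve 2 (λ q r → q :* con 2 :+ (con 1 :+ r :* con 2) := con 1 :+ (q :+ r) :* con 2) refl q r))
         (oddBit-odd (q + r)))
  (oddBit-even q)
... | odd q = cong₂ _+_
  (trans (cong oddBit (solve 2 (λ q r → con 1 :+ q :* con 2 :+ (con 1 :+ r :* con 2) := (con 1 :+ q :+ r) :* con 2) refl q r))
         (oddBit-even (1 + q + r)))
  (oddBit-odd q)

T1^-+2^ : ∀ k b → T1^ k (2 ^ k + b) ≡ T1^ k b + 3 ^ oddCount k b
T1^-+2^ k b = begin
  T1^ k (2 ^ k + b)                        ≡⟨ cong (T1^ k) shape ⟩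
  T1^ k (b + 2 ^ (k + 0) * 1)              ≡⟨ T1^-affine k 0 b 1 ⟩
  T1^ k b + 3 ^ oddCount k b * 1 * 1       ≡⟨ cong (_+_ (T1^ k b)) (trans (*-identityʳ _) (*-identityʳ _)) ⟩
  T1^ k b + 3 ^ oddCount k b               ∎
  where
  shape : 2 ^ k + b ≡ b + 2 ^ (k + 0) * 1
  shape rewrite +-identityʳ k | *-identityʳ (2 ^ k) = +-comm (2 ^ k) b

oddBit-T1^-flip : ∀ k b → oddBit (T1^ k (2 ^ k + b)) + oddBit (T1^ k b) ≡ 1
oddBit-T1^-flip k b with 3^-odd (oddCount k b)
... | r , 3^M≡ = trans (cong (λ e → oddBit e + oddBit (T1^ k b)) (trans (T1^-+2^ k b) (cong (_+_ (T1^ k b)) 3^M≡)))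
                       (oddBit-+odd (T1^ k b) r)

sumBelow : (ℕ → ℕ) → ℕ → ℕ
sumBelow f zero    = 0
sumBelow f (suc N) = sumBelow f N + f N

sumBelow-cong : ∀ {f h} N → (∀ i → i < N → f i ≡ h i) → sumBelow f N ≡ sumBelow h N
sumBelow-cong zero    f≡h = refl
sumBelow-cong (suc N) f≡h = cong₂ _+_ (sumBelow-cong N (λ i i<N → f≡h i (m<n⇒m<1+n i<N))) (f≡h N ≤-refl)

sumBelow-+ : ∀ f h N → sumBelow f N + sumBelow h N ≡ sumBelow (λ i → f i + h i) N
sumBelow-+ f h zero    = refl
sumBelow-+ f h (suc N) = trans
  (solve 4 (λ a b c d → (a :+ b) :+ (c :+ d) := (a :+ c) :+ (b :+ d)) refl (sumBelow f N) (f N) (sumBelow h N) (h N))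
  (cong (_+ (f N + h N)) (sumBelow-+ f h N))

sumBelow-const : ∀ c N → sumBelow (λ _ → c) N ≡ N * c
sumBelow-const c zero    = refl
sumBelow-const c (suc N) = trans (cong (_+ c) (sumBelow-const c N)) (+-comm (N * c) c)

sumBelow-split : ∀ f a b → sumBelow f (a + b) ≡ sumBelow f a + sumBelow (λ i → f (a + i)) b
sumBelow-split f a zero    = trans (cong (sumBelow f) (+-identityʳ a)) (sym (+-identityʳ _))
sumBelow-split f a (suc b) = trans (cong (sumBelow f) (+-suc a b))
  (trans (cong (_+ f (a + b)) (sumBelow-split f a b)) (+-assoc (sumBelow f a) _ _))

sumBelow-comm : ∀ (G : ℕ → ℕ → ℕ) n N →
                sumBelow (λ b → sumBelow (λ k → G k b) n) N ≡ sumBelow (λ k → sumBelow (G k) N) n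
sumBelow-comm G zero    N = trans (sumBelow-const 0 N) (*-zeroʳ N)
sumBelow-comm G (suc n) N = trans (sym (sumBelow-+ (λ b → sumBelow (λ k → G k b) n) (G n) N))
                                  (cong (_+ sumBelow (G n) N) (sumBelow-comm G n N))

sumBelow-complementary : ∀ P h → (∀ b → h (P + b) + h b ≡ 1) → ∀ q → sumBelow h (q * (P + P)) ≡ q * P
sumBelow-complementary P h h-flip zero    = refl
sumBelow-complementary P h h-flip (suc q) = begin
  sumBelow h (P + P + q * (P + P))                                         ≡⟨ sumBelow-split h (P + P) (q * (P + P)) ⟩
  sumBelow h (P + P) + sumBelow (λ i → h (P + P + i)) (q * (P + P))        ≡⟨ cong₂ _+_ firstBlock
                                                                               (sumBelow-complementary P _ shifted-flip q) ⟩
  P + q * P                                                                ∎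
  where
  firstBlock : sumBelow h (P + P) ≡ P
  firstBlock = begin
    sumBelow h (P + P)                                 ≡⟨ sumBelow-split h P P ⟩
    sumBelow h P + sumBelow (λ i → h (P + i)) P        ≡⟨ sumBelow-+ h _ P ⟩
    sumBelow (λ i → h i + h (P + i)) P                 ≡⟨ sumBelow-cong P (λ i _ → trans (+-comm (h i) _) (h-flip i)) ⟩
    sumBelow (λ _ → 1) P                               ≡⟨ trans (sumBelow-const 1 P) (*-identityʳ P) ⟩
    P                                                  ∎
  shifted-flip : ∀ b → h (P + P + (P + b)) + h (P + P + b) ≡ 1
  shifted-flip b = trans (cong (λ e → h e + h (P + P + b))
                               (solve 2 (λ P b → P :+ P :+ (P :+ b) := P :+ (P :+ P :+ b)) refl P b))
                         (h-flip (P + P + b))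

sum-upTo : ∀ f N → sum (map f (upTo N)) ≡ sumBelow f N
sum-upTo f zero    = refl
sum-upTo f (suc N) = begin
  sum (map f (upTo (suc N)))         ≡⟨ cong (λ l → sum (map f l)) (sym (upTo-∷ʳ N)) ⟩
  sum (map f (upTo N ++ [ N ]))      ≡⟨ cong sum (map-++ f (upTo N) [ N ]) ⟩
  sum (map f (upTo N) ++ [ f N ])    ≡⟨ sum-++ (map f (upTo N)) [ f N ] ⟩
  sum (map f (upTo N)) + (f N + 0)   ≡⟨ cong₂ _+_ (sum-upTo f N) (+-identityʳ (f N)) ⟩
  sumBelow f N + f N                 ∎

oddCount≡sumBelow : ∀ n b → oddCount n b ≡ sumBelow (λ k → oddBit (T1^ k b)) n
oddCount≡sumBelow zero    b = refl
oddCount≡sumBelow (suc n) b = cong (_+ oddBit (T1^ n b)) (oddCount≡sumBelow n b)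

sumBelow-oddBit-T1^ : ∀ m k → k < suc m → sumBelow (λ b → oddBit (T1^ k b)) (2 ^ suc m) ≡ 2 ^ m
sumBelow-oddBit-T1^ m k (s≤s k≤m) with m≤n⇒∃[o]m+o≡n k≤m
... | d , refl = begin
  sumBelow h (2 ^ suc (k + d))       ≡⟨ cong (sumBelow h) blocks ⟩
  sumBelow h (2 ^ d * (P + P))       ≡⟨ sumBelow-complementary P h (oddBit-T1^-flip k) (2 ^ d) ⟩
  2 ^ d * P                          ≡⟨ sym 2^[k+d]≡ ⟩
  2 ^ (k + d)                        ∎
  where
  h = λ b → oddBit (T1^ k b)
  P = 2 ^ k
  2^[k+d]≡ : 2 ^ (k + d) ≡ 2 ^ d * P
  2^[k+d]≡ = trans (^-distribˡ-+-* 2 k d) (*-comm P (2 ^ d))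
  blocks : 2 ^ suc (k + d) ≡ 2 ^ d * (P + P)
  blocks = trans (cong (2 *_) 2^[k+d]≡) (solve 2 (λ P D → con 2 :* (D :* P) := D :* (P :+ P)) refl P (2 ^ d))

sumBelow-M : ∀ m → sumBelow (M (suc m)) (2 ^ suc m) ≡ 2 ^ m * suc m
sumBelow-M m = begin
  sumBelow (M (suc m)) (2 ^ suc m)                                    ≡⟨ sumBelow-cong (2 ^ suc m) (λ b _ → oddCount≡sumBelow (suc m) b) ⟩
  sumBelow (λ b → sumBelow (λ k → oddBit (T1^ k b)) (suc m)) (2 ^ suc m) ≡⟨ sumBelow-comm (λ k b → oddBit (T1^ k b)) (suc m) (2 ^ suc m) ⟩
  sumBelow (λ k → sumBelow (λ b → oddBit (T1^ k b)) (2 ^ suc m)) (suc m) ≡⟨ sumBelow-cong (suc m) (sumBelow-oddBit-T1^ m) ⟩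
  sumBelow (λ _ → 2 ^ m) (suc m)                                      ≡⟨ sumBelow-const (2 ^ m) (suc m) ⟩
  suc m * 2 ^ m                                                       ≡⟨ *-comm (suc m) (2 ^ m) ⟩
  2 ^ m * suc m                                                       ∎

fromℕ : ℕ → ℚ
fromℕ x = + x / 1

fromℕ≡mkℚ : ∀ x → fromℕ x ≡ mkℚ (+ x) 0 (Coprimality.sym (Coprimality.1-coprimeTo x))
fromℕ≡mkℚ x = ℚP.normalize-coprime (Coprimality.sym (Coprimality.1-coprimeTo x))

fromℕ-* : ∀ x y → fromℕ (x * y) ≡ fromℕ x ℚ.* fromℕ y
fromℕ-* x y rewrite fromℕ≡mkℚ x | fromℕ≡mkℚ y = cong (_/ 1) (ℤP.pos-* x y)

fromℕ-^ : ∀ x s → fromℕ (x ^ s) ≡ fromℕ x ^ℚ s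
fromℕ-^ x zero    = refl
fromℕ-^ x (suc s) = trans (fromℕ-* x (x ^ s)) (cong (fromℕ x ℚ.*_) (fromℕ-^ x s))

^ℚ-distribˡ-+-* : ∀ x a b → x ^ℚ (a + b) ≡ x ^ℚ a ℚ.* x ^ℚ b
^ℚ-distribˡ-+-* x zero    b = sym (ℚP.*-identityˡ _)
^ℚ-distribˡ-+-* x (suc a) b = trans (cong (x ℚ.*_) (^ℚ-distribˡ-+-* x a b)) (sym (ℚP.*-assoc x _ _))

^ℚ-distribʳ-* : ∀ x y a → (x ℚ.* y) ^ℚ a ≡ x ^ℚ a ℚ.* y ^ℚ a
^ℚ-distribʳ-* x y zero    = refl
^ℚ-distribʳ-* x y (suc a) = trans (cong ((x ℚ.* y) ℚ.*_) (^ℚ-distribʳ-* x y a)) (interchange x y _ _)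

^ℚ-*-assoc : ∀ x a b → (x ^ℚ a) ^ℚ b ≡ x ^ℚ (a * b)
^ℚ-*-assoc x a zero    = cong (x ^ℚ_) (sym (*-zeroʳ a))
^ℚ-*-assoc x a (suc b) = begin
  x ^ℚ a ℚ.* (x ^ℚ a) ^ℚ b     ≡⟨ cong (x ^ℚ a ℚ.*_) (^ℚ-*-assoc x a b) ⟩
  x ^ℚ a ℚ.* x ^ℚ (a * b)      ≡⟨ sym (^ℚ-distribˡ-+-* x a (a * b)) ⟩
  x ^ℚ (a + a * b)             ≡⟨ cong (x ^ℚ_) (sym (*-suc a b)) ⟩
  x ^ℚ (a * suc b)             ∎

prodℚ-map-^* : ∀ x y (f : ℕ → ℕ) xs →
               prodℚ (map (λ b → x ^ℚ f b ℚ.* y) xs) ≡ x ^ℚ sum (map f xs) ℚ.* y ^ℚ length xs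
prodℚ-map-^* x y f []       = refl
prodℚ-map-^* x y f (b ∷ xs) = begin
  (x ^ℚ f b ℚ.* y) ℚ.* prodℚ (map (λ b → x ^ℚ f b ℚ.* y) xs)   ≡⟨ cong ((x ^ℚ f b ℚ.* y) ℚ.*_) (prodℚ-map-^* x y f xs) ⟩
  (x ^ℚ f b ℚ.* y) ℚ.* (x ^ℚ S ℚ.* y ^ℚ length xs)            ≡⟨ interchange (x ^ℚ f b) y _ _ ⟩
  (x ^ℚ f b ℚ.* x ^ℚ S) ℚ.* (y ℚ.* y ^ℚ length xs)            ≡⟨ cong (ℚ._* _) (sym (^ℚ-distribˡ-+-* x (f b) S)) ⟩
  x ^ℚ (f b + S) ℚ.* y ^ℚ suc (length xs)                      ∎
  where S = sum (map f xs)

K≡ : ∀ n → K n ≡ fromℕ 3 ^ℚ sumBelow (M n) (2 ^ n) ℚ.* (½ ^ℚ n) ^ℚ (2 ^ n)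
K≡ n = begin
  prodℚ (map (A n) (upTo (2 ^ n)))                                     ≡⟨ cong prodℚ (map-cong A≡ (upTo (2 ^ n))) ⟩
  prodℚ (map (λ b → fromℕ 3 ^ℚ M n b ℚ.* ½ ^ℚ n) (upTo (2 ^ n)))       ≡⟨ prodℚ-map-^* (fromℕ 3) (½ ^ℚ n) (M n) (upTo (2 ^ n)) ⟩
  fromℕ 3 ^ℚ sum (map (M n) (upTo (2 ^ n))) ℚ.* (½ ^ℚ n) ^ℚ length (upTo (2 ^ n))
                                                                       ≡⟨ cong₂ (λ s l → fromℕ 3 ^ℚ s ℚ.* (½ ^ℚ n) ^ℚ l)
                                                                                (sum-upTo (M n) (2 ^ n)) (length-upTo (2 ^ n)) ⟩
  fromℕ 3 ^ℚ sumBelow (M n) (2 ^ n) ℚ.* (½ ^ℚ n) ^ℚ (2 ^ n)            ∎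
  where
  A≡ : ∀ b → A n b ≡ fromℕ 3 ^ℚ M n b ℚ.* ½ ^ℚ n
  A≡ b = cong (ℚ._* (½ ^ℚ n)) (fromℕ-^ 3 (M n b))

mainTheorem1 : (m : ℕ) → K (suc m) ≡ (((+ 3) / 4) ^ℚ ((2 ^ m) * suc m))
mainTheorem1 m = begin
  K n                                                 ≡⟨ K≡ n ⟩
  fromℕ 3 ^ℚ sumBelow (M n) (2 ^ n) ℚ.* (½ ^ℚ n) ^ℚ (2 ^ n)
                                                      ≡⟨ cong₂ (λ s h → fromℕ 3 ^ℚ s ℚ.* h) (sumBelow-M m) (^ℚ-*-assoc ½ n (2 ^ n)) ⟩
  fromℕ 3 ^ℚ a ℚ.* ½ ^ℚ (n * 2 ^ n)                   ≡⟨ cong (λ e → fromℕ 3 ^ℚ a ℚ.* ½ ^ℚ e) exponent ⟩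
  fromℕ 3 ^ℚ a ℚ.* ½ ^ℚ (2 * a)                       ≡⟨ cong (fromℕ 3 ^ℚ a ℚ.*_) (sym (^ℚ-*-assoc ½ 2 a)) ⟩
  fromℕ 3 ^ℚ a ℚ.* (½ ^ℚ 2) ^ℚ a                      ≡⟨ sym (^ℚ-distribʳ-* (fromℕ 3) (½ ^ℚ 2) a) ⟩
  (fromℕ 3 ℚ.* ½ ^ℚ 2) ^ℚ a                           ≡⟨⟩
  ((+ 3) / 4) ^ℚ a                                    ∎
  where
  n = suc m
  a = 2 ^ m * suc m
  exponent : n * 2 ^ n ≡ 2 * a
  exponent = solve 2 (λ m P → (con 1 :+ m) :* (con 2 :* P) := con 2 :* (P :* (con 1 :+ m))) refl m (2 ^ m)
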